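{- Let $\lambda=s_1^{m_1}s_2^{m_2}\cdots s_r^{m_r}$ be a partition with $s_1>s_2>\cdots>s_r\ge1$, $m_i\ge1$, so $r=\sigma(\lambda)$, and set $\widehat g_i=s_i-s_{i+1}$ for $1\le i\le r$ with the convention $s_{r+1}=0$. The following are equivalent: (1) $\operatorname{deg}(\lambda)=\sigma(\lambda)(\sigma(\lambda)-1)$, where $\operatorname{deg}(\lambda)$ is the degree of $\lambda$ in $G_{|\lambda|}$; (2) $m_i=1$ for all $i$ and $\widehat g_i=1$ for all $i$; (3) $\lambda$ is the staircase partition $(r,r-1,\dots,2,1)$ with $r=\sigma(\lambda)$.
   Context: $G_n$ is the partition graph: its vertices are the partitions of $n$, and two distinct partitions $\lambda\neq\mu$ are adjacent when $\mu$ is obtained from $\lambda$ by moving one cell from one part (of size $x$, the part shrinking to $x-1$ and disappearing if $x=1$) to another part or to a new part of size $1$, followed by reordering the parts in weakly decreasing order. The notation $s^m$ means the part size $s$ repeated $m$ times; $\sigma(\lambda)$ is the number of distinct part sizes of $\lambda$. -}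

module Defs where

open import Data.Nat using (ℕ; zero; suc; _∸_; _<_; _≤_; pred; _≟_)
open import Data.Nat.Properties using (_≤?_)
open import Data.List using (List; []; _∷_; _++_; [_]; length; deduplicate)
open import Data.List.Relation.Unary.All using (All)
open import Data.List.Relation.Unary.Linked using (Linked)
open import Data.List.Relation.Unary.Unique.Propositional using (Unique)
open import Data.List.Membership.Propositional using (_∈_)
open import Data.List.Relation.Binary.Permutation.Propositional using (_↭_)
open import Data.Product using (_×_; ∃; ∃-syntax)
open import Relation.Binary.PropositionalEquality using (_≡_; _≢_)
open import Relation.Nullary using (does)
open import Data.Bool using (true; false)
open import Function.Bundles using (_⇔_)

IsPartition : List ℕ → Set
IsPartition l = Linked (λ x y → y ≤ x) l × All (λ x → 1 ≤ x) l

modAt : ℕ → (ℕ → ℕ) → List ℕ → List ℕ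
modAt i f [] = []
modAt zero f (x ∷ xs) = f x ∷ xs
modAt (suc i) f (x ∷ xs) = x ∷ modAt i f xs

removeZeros : List ℕ → List ℕ
removeZeros [] = []
removeZeros (zero ∷ xs) = removeZeros xs
removeZeros (suc x ∷ xs) = suc x ∷ removeZeros xs

-- One move: remove a cell from part i and add it to part j ≠ i, or to a new part of size 1
-- (before deleting empty parts and reordering).
data Step (l : List ℕ) : List ℕ → Set where
  toPart : (i j : ℕ) → i < length l → j < length l → i ≢ j →
           Step l (modAt j suc (modAt i pred l))
  toNew  : (i : ℕ) → i < length l → Step l (modAt i pred l ++ [ 1 ])

Adj : List ℕ → List ℕ → Set
Adj l μ = IsPartition μ × l ≢ μ × ∃[ ν ] (Step l ν × removeZeros ν ↭ μ)

DegreeIs : List ℕ → ℕ → Set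
DegreeIs l d = ∃[ L ] (Unique L × (∀ μ → (μ ∈ L) ⇔ Adj l μ) × length L ≡ d)

distinctParts : List ℕ → List ℕ
distinctParts l = deduplicate _≟_ l

σ : List ℕ → ℕ
σ l = length (distinctParts l)

mult : ℕ → List ℕ → ℕ
mult s [] = zero
mult s (x ∷ xs) with does (s ≟ x)
... | true = suc (mult s xs)
... | false = mult s xs

gaps : List ℕ → List ℕ
gaps [] = []
gaps (x ∷ []) = x ∷ []
gaps (x ∷ y ∷ r) = (x ∸ y) ∷ gaps (y ∷ r)

staircase : ℕ → List ℕ
staircase zero = []
staircase (suc r) = suc r ∷ staircase r

{-# OPTIONS --safe #-}
-- As far as the resulting partition is concerned, a move is determined by the
-- size s of the part losing a cell and the size t of the part receiving it
-- (t = 0 for a new part): the multiset of parts loses s and t and gains s − 1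
-- and t + 1.  The move is idle exactly when t + 1 = s, and two non-idle moves
-- (s, t), (s′, t′) with the same result coincide, since the identity
-- {s, t, s′ − 1, t′ + 1} = {s′, t′, s − 1, t + 1} of multisets of positive
-- numbers forces s = s′ and t = t′.  Hence deg λ = Σₛ c(s), where c(s) counts
-- the targets t ∈ {s₁, …, s_r, 0} with t + 1 ≠ s and (t ≠ s or mₛ ≥ 2).  Of
-- these σ + 1 targets at most s and s − 1 are excluded, so c(s) ≥ σ − 1, with
-- equality iff mₛ = 1 and s − 1 is a part size or 0.  The degree is σ(σ − 1)
-- iff this holds for every part size s, i.e. iff the distinct part sizes are
-- r, r − 1, …, 1, each occurring once.
module Submission where

open import Defs
open import Data.Nat using (ℕ; _*_; _∸_)
open import Data.List using (List)
open import Data.List.Relation.Unary.All using (All)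
open import Data.Product using (_×_)
open import Relation.Binary.PropositionalEquality using (_≡_)
open import Function.Bundles using (_⇔_)

open import Level using (0ℓ)
open import Function using (_∘_)
open import Function.Bundles using (mk⇔; module Equivalence)
import Function.Properties.Equivalence as ⇔
open import Data.Bool using (true; false; if_then_else_)
open import Data.Sum using (_⊎_; inj₁; inj₂)
open import Data.Product using (_,_; proj₁; proj₂; map₁; Σ-syntax; ∃₂; uncurry)
open import Data.Nat using (zero; suc; pred; _+_; _≤_; _<_; _≥_; _>_; z≤n; s≤s; s≤s⁻¹)
open import Data.Nat.Properties
open import Data.Nat.ListAction using (sum)
open import Algebra.Properties.CommutativeSemigroup +-commutativeSemigroup using (interchange)
open import Data.List
  using ([]; _∷_; _++_; [_]; length; filter; map; cartesianProduct; deduplicate)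
open import Data.List.Properties
  using (length-++; length-map; filter-++; filter-some; filter-none; filter-notAll; filter-all;
         ∷-injectiveˡ; ≡-dec)
open import Data.List.Membership.Propositional using (_∈_; _∉_)
open import Data.List.Membership.Propositional.Properties
  using (∈-filter⁺; ∈-filter⁻; ∈-map⁺; ∈-map⁻; ∈-++⁺ˡ; ∈-++⁺ʳ; ∈-++⁻; ∈-length;
         ∈-cartesianProduct⁺; ∈-cartesianProduct⁻; ∈-deduplicate⁺; ∈-deduplicate⁻)
open import Data.List.Membership.DecPropositional _≟_ using (_∈?_)
open import Data.List.Relation.Binary.Subset.Propositional using (_⊆_)
open import Data.List.Relation.Unary.Any using (here; there)
import Data.List.Relation.Unary.Any as Any
import Data.List.Relation.Unary.All as All
open import Data.List.Relation.Unary.All using ([]; _∷_)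
open import Data.List.Relation.Unary.All.Properties using (¬Any⇒All¬; All¬⇒¬Any)
import Data.List.Relation.Unary.All.Properties as All
open import Data.List.Relation.Unary.AllPairs using (AllPairs; []; _∷_)
import Data.List.Relation.Unary.AllPairs as AllPairs
open import Data.List.Relation.Unary.Linked using (Linked; []; [-]; _∷_)
open import Data.List.Relation.Unary.Linked.Properties using (Linked⇒AllPairs)
open import Data.List.Relation.Unary.Unique.Propositional using (Unique)
open import Data.List.Relation.Unary.Unique.Propositional.Properties
  using (filter⁺; cartesianProduct⁺; ++⁺)
open import Data.List.Relation.Unary.Unique.DecPropositional.Properties _≟_ using (deduplicate-!)
open import Data.List.Relation.Binary.Permutation.Propositional
  using (_↭_; prep; swap; ↭-refl; ↭-sym; module PermutationReasoning)
open import Data.List.Relation.Binary.Permutation.Propositional.Properties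
  using (↭-length; filter-↭; ∷↭∷ʳ; All-resp-↭)
open import Relation.Binary.Definitions using (DecidableEquality)
open import Relation.Binary.Properties.DecTotalOrder ≤-decTotalOrder using (≥-decTotalOrder)
open import Data.List.Sort ≥-decTotalOrder using (sort; sort-↭; sort-↗)
open import Relation.Binary.PropositionalEquality
  using (_≢_; ≢-sym; refl; sym; trans; cong; cong₂; subst; subst₂; module ≡-Reasoning)
open import Relation.Nullary using (¬_; Dec; yes; no; does; proof; contradiction; ¬?)
open import Relation.Nullary.Reflects using (ofʸ; ofⁿ)
open import Relation.Nullary.Decidable using (_×-dec_; _⊎-dec_)
open import Relation.Unary using (Pred; Decidable)
open import Relation.Unary.Properties using (∁?)

private
  variable
    a a′ s s′ t t′ v w x y : ℕ
    l μ μ′ ν xs ys us vs : List ℕ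

module _ {A : Set} (_≟A_ : DecidableEquality A) where

  Unique-⊆⇒length≤ : {xs ys : List A} → Unique xs → xs ⊆ ys → length xs ≤ length ys
  Unique-⊆⇒length≤ {[]} _ _ = z≤n
  Unique-⊆⇒length≤ {x ∷ xs} {ys} (x∉xs ∷ xs-unique) x∷xs⊆ys = begin
    suc (length xs)                        ≤⟨ s≤s (Unique-⊆⇒length≤ xs-unique xs⊆ys-x) ⟩
    suc (length (filter (¬? ∘ (x ≟A_)) ys)) ≤⟨ filter-notAll (¬? ∘ (x ≟A_)) ys x∈ys ⟩
    length ys                              ∎
    where
    open ≤-Reasoning
    x∈ys = Any.map (λ x≡y x≢y → x≢y x≡y) (x∷xs⊆ys (here refl))
    xs⊆ys-x : xs ⊆ filter (¬? ∘ (x ≟A_)) ys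
    xs⊆ys-x z∈xs = ∈-filter⁺ (¬? ∘ (x ≟A_)) (x∷xs⊆ys (there z∈xs)) (All.lookup x∉xs z∈xs)

  Unique-length-≡ : {xs ys : List A} → Unique xs → Unique ys →
                    (∀ {z} → z ∈ xs ⇔ z ∈ ys) → length xs ≡ length ys
  Unique-length-≡ xs-unique ys-unique xs⇔ys = ≤-antisym
    (Unique-⊆⇒length≤ xs-unique (Equivalence.to xs⇔ys))
    (Unique-⊆⇒length≤ ys-unique (Equivalence.from xs⇔ys))

module _ {A : Set} where

  length-filter+∁ : {P : Pred A 0ℓ} (P? : Decidable P) (xs : List A) →
                    length (filter P? xs) + length (filter (∁? P?) xs) ≡ length xs
  length-filter+∁ P? [] = refl
  length-filter+∁ P? (x ∷ xs) with does (P? x)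
  ... | true  = cong suc (length-filter+∁ P? xs)
  ... | false = trans (+-suc _ _) (cong suc (length-filter+∁ P? xs))

  Unique-map⁺ : {B : Set} {f : A → B} {xs : List A} →
                (∀ {x y} → x ∈ xs → y ∈ xs → f x ≡ f y → x ≡ y) → Unique xs → Unique (map f xs)
  Unique-map⁺ {xs = []} _ [] = []
  Unique-map⁺ {xs = x ∷ xs} injective (x∉xs ∷ xs-unique) =
    All.map⁺ (All.tabulate λ y∈xs fx≡fy →
                All.lookup x∉xs y∈xs (injective (here refl) (there y∈xs) fx≡fy))
    ∷ Unique-map⁺ (λ x∈ y∈ → injective (there x∈) (there y∈)) xs-unique

  All-⇔ : {P Q : Pred A 0ℓ} {xs : List A} → (∀ {x} → x ∈ xs → P x ⇔ Q x) → All P xs ⇔ All Q xs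
  All-⇔ P⇔Q = mk⇔ (λ ps → All.tabulate λ x∈ → Equivalence.to (P⇔Q x∈) (All.lookup ps x∈))
                   (λ qs → All.tabulate λ x∈ → Equivalence.from (P⇔Q x∈) (All.lookup qs x∈))

length-filter-cartesianProduct :
  {A B : Set} {P : Pred (A × B) 0ℓ} (P? : Decidable P) (xs : List A) (ys : List B) →
  length (filter P? (cartesianProduct xs ys)) ≡ sum (map (λ x → length (filter (λ y → P? (x , y)) ys)) xs)
length-filter-cartesianProduct P? [] ys = refl
length-filter-cartesianProduct P? (x ∷ xs) ys = begin
  length (filter P? (map (x ,_) ys ++ cartesianProduct xs ys))
    ≡⟨ cong length (filter-++ P? (map (x ,_) ys) (cartesianProduct xs ys)) ⟩
  length (filter P? (map (x ,_) ys) ++ filter P? (cartesianProduct xs ys))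
    ≡⟨ length-++ (filter P? (map (x ,_) ys)) ⟩
  length (filter P? (map (x ,_) ys)) + length (filter P? (cartesianProduct xs ys))
    ≡⟨ cong₂ _+_ (length-filter-map ys) (length-filter-cartesianProduct P? xs ys) ⟩
  length (filter (λ y → P? (x , y)) ys) + sum (map (λ x → length (filter (λ y → P? (x , y)) ys)) xs) ∎
  where
  open ≡-Reasoning
  length-filter-map : ∀ zs → length (filter P? (map (x ,_) zs)) ≡ length (filter (λ y → P? (x , y)) zs)
  length-filter-map [] = refl
  length-filter-map (z ∷ zs) with does (P? (x , z))
  ... | true  = cong suc (length-filter-map zs)
  ... | false = length-filter-map zs

module _ {A : Set} (f : A → ℕ) (k : ℕ) where

  sum-map-≥ : {xs : List A} → All (λ x → k ≤ f x) xs → length xs * k ≤ sum (map f xs)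
  sum-map-≥ [] = z≤n
  sum-map-≥ (k≤fx ∷ k≤f) = +-mono-≤ k≤fx (sum-map-≥ k≤f)

  sum-map-≡⇔ : {xs : List A} → All (λ x → k ≤ f x) xs →
               sum (map f xs) ≡ length xs * k ⇔ All (λ x → f x ≡ k) xs
  sum-map-≡⇔ [] = mk⇔ (λ _ → []) (λ _ → refl)
  sum-map-≡⇔ {x ∷ xs} (k≤fx ∷ k≤f) = mk⇔ to from
    where
    to : f x + sum (map f xs) ≡ k + length xs * k → All (λ x → f x ≡ k) (x ∷ xs)
    to eq = fx≡k ∷ Equivalence.to (sum-map-≡⇔ k≤f)
                      (+-cancelˡ-≡ k _ _ (trans (cong (_+ _) (sym fx≡k)) eq))
      where
      fx≡k : f x ≡ k
      fx≡k = ≤-antisym (+-cancelˡ-≤ _ (f x) k (begin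
        length xs * k + f x   ≡⟨ +-comm _ (f x) ⟩
        f x + length xs * k   ≤⟨ +-monoʳ-≤ (f x) (sum-map-≥ k≤f) ⟩
        f x + sum (map f xs)  ≡⟨ eq ⟩
        k + length xs * k     ≡⟨ +-comm k _ ⟩
        length xs * k + k     ∎)) k≤fx
        where open ≤-Reasoning
    from : All (λ x → f x ≡ k) (x ∷ xs) → f x + sum (map f xs) ≡ k + length xs * k
    from (fx≡k ∷ f≡k) = cong₂ _+_ fx≡k (Equivalence.from (sum-map-≡⇔ k≤f) f≡k)

+-cross-cancel : ∀ {a b a′ b′ m n} → a + m ≡ b + n → a′ + m ≡ b′ + n → a + b′ ≡ a′ + b
+-cross-cancel {a} {b} {a′} {b′} {m} {n} e e′ = +-cancelʳ-≡ (m + n) _ _ (begin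
  (a + b′) + (m + n)  ≡⟨ interchange a m b′ n ⟨
  (a + m) + (b′ + n)  ≡⟨ cong₂ _+_ e (sym e′) ⟩
  (b + n) + (a′ + m)  ≡⟨ +-comm (b + n) _ ⟩
  (a′ + m) + (b + n)  ≡⟨ interchange a′ m b n ⟩
  (a′ + b) + (m + n)  ∎)
  where open ≡-Reasoning

m+n≡o+1⇒o∸1≤m : ∀ {m n o} → m + n ≡ o + 1 → n ≤ 2 → o ∸ 1 ≤ m
m+n≡o+1⇒o∸1≤m {o = zero} _ _ = z≤n
m+n≡o+1⇒o∸1≤m {m} {n} {suc k} m+n≡ n≤2 = +-cancelʳ-≤ 2 k m (begin
  k + 2      ≡⟨ +-suc k 1 ⟩
  suc k + 1  ≡⟨ m+n≡ ⟨
  m + n      ≤⟨ +-monoʳ-≤ m n≤2 ⟩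
  m + 2      ∎)
  where open ≤-Reasoning

m+n≡o+1⇒[m≡o∸1⇔2≤n] : ∀ {m n o} → 1 ≤ o → m + n ≡ o + 1 → n ≤ 2 → m ≡ o ∸ 1 ⇔ 2 ≤ n
m+n≡o+1⇒[m≡o∸1⇔2≤n] {m} {n} {suc k} _ m+n≡ n≤2 = mk⇔
  (λ m≡k → ≤-reflexive (sym (+-cancelˡ-≡ m _ _ (trans m+n≡k+2 (cong (_+ 2) (sym m≡k))))))
  (λ 2≤n → +-cancelʳ-≡ 2 m k (trans (cong (m +_) (sym (≤-antisym n≤2 2≤n))) m+n≡k+2))
  where
  m+n≡k+2 : m + n ≡ k + 2
  m+n≡k+2 = trans m+n≡ (sym (+-suc k 1))

mult≡count : ∀ v xs → mult v xs ≡ length (filter (v ≟_) xs)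
mult≡count v [] = refl
mult≡count v (x ∷ xs) with does (v ≟ x)
... | true  = cong suc (mult≡count v xs)
... | false = mult≡count v xs

mult-++ : ∀ v xs ys → mult v (xs ++ ys) ≡ mult v xs + mult v ys
mult-++ v xs ys = begin
  mult v (xs ++ ys)                                     ≡⟨ mult≡count v (xs ++ ys) ⟩
  length (filter (v ≟_) (xs ++ ys))                     ≡⟨ cong length (filter-++ (v ≟_) xs ys) ⟩
  length (filter (v ≟_) xs ++ filter (v ≟_) ys)         ≡⟨ length-++ (filter (v ≟_) xs) ⟩
  length (filter (v ≟_) xs) + length (filter (v ≟_) ys) ≡⟨ cong₂ _+_ (mult≡count v xs) (mult≡count v ys) ⟨
  mult v xs + mult v ys                                 ∎
  where open ≡-Reasoning

mult-↭ : ∀ v → xs ↭ ys → mult v xs ≡ mult v ys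
mult-↭ {xs} {ys} v xs↭ys = begin
  mult v xs                  ≡⟨ mult≡count v xs ⟩
  length (filter (v ≟_) xs)  ≡⟨ ↭-length (filter-↭ (v ≟_) xs↭ys) ⟩
  length (filter (v ≟_) ys)  ≡⟨ mult≡count v ys ⟨
  mult v ys                  ∎
  where open ≡-Reasoning

mult-here : ∀ x xs → mult x (x ∷ xs) ≡ suc (mult x xs)
mult-here x xs with does (x ≟ x) | proof (x ≟ x)
... | true  | _        = refl
... | false | ofⁿ x≢x = contradiction refl x≢x

mult-there : v ≢ x → mult v (x ∷ xs) ≡ mult v xs
mult-there {v} {x} v≢x with does (v ≟ x) | proof (v ≟ x)
... | true  | ofʸ v≡x = contradiction v≡x v≢x
... | false | _        = refl

mult-∷-≤ : ∀ v x xs → mult v xs ≤ mult v (x ∷ xs)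
mult-∷-≤ v x xs with does (v ≟ x)
... | true  = n≤1+n _
... | false = ≤-refl

∈⇒mult>0 : x ∈ xs → 0 < mult x xs
∈⇒mult>0 {x} {xs} x∈xs = subst (0 <_) (sym (mult≡count x xs)) (filter-some (x ≟_) x∈xs)

∉⇒mult≡0 : x ∉ xs → mult x xs ≡ 0
∉⇒mult≡0 {x} {xs} x∉xs = trans (mult≡count x xs) (cong length (filter-none (x ≟_) (¬Any⇒All¬ xs x∉xs)))

mult>0⇒∈ : 0 < mult x xs → x ∈ xs
mult>0⇒∈ {x} {xs} mult>0 with x ∈? xs
... | yes x∈xs = x∈xs
... | no  x∉xs = contradiction (∉⇒mult≡0 x∉xs) (>⇒≢ mult>0)

Unique⇒mult≤1 : Unique xs → mult v xs ≤ 1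
Unique⇒mult≤1 [] = z≤n
Unique⇒mult≤1 {x ∷ xs} {v} (x∉xs ∷ xs-unique) with v ≟ x
... | yes refl = subst (_≤ 1) (sym (mult-here v xs)) (s≤s (≤-reflexive (∉⇒mult≡0 (All¬⇒¬Any x∉xs))))
... | no  v≢x  = subst (_≤ 1) (sym (mult-there v≢x)) (Unique⇒mult≤1 xs-unique)

mult≤1⇒Unique : (∀ v → mult v xs ≤ 1) → Unique xs
mult≤1⇒Unique {[]} _ = []
mult≤1⇒Unique {x ∷ xs} mult≤1 =
  All.tabulate x≢ ∷ mult≤1⇒Unique (λ v → ≤-trans (mult-∷-≤ v x xs) (mult≤1 v))
  where
  x≢ : y ∈ xs → x ≢ y
  x≢ y∈xs refl = contradiction
    (≤-trans (∈⇒mult>0 y∈xs) (s≤s⁻¹ (subst (_≤ 1) (mult-here x xs) (mult≤1 x)))) λ ()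

Unique-∈⇒mult≡1 : Unique xs → x ∈ xs → mult x xs ≡ 1
Unique-∈⇒mult≡1 xs-unique x∈xs = ≤-antisym (Unique⇒mult≤1 xs-unique) (∈⇒mult>0 x∈xs)

deduplicate-Unique : Unique xs → deduplicate _≟_ xs ≡ xs
deduplicate-Unique [] = refl
deduplicate-Unique {x ∷ xs} (x∉xs ∷ xs-unique) =
  cong (x ∷_) (trans (cong (filter (¬? ∘ (x ≟_))) (deduplicate-Unique xs-unique))
                     (filter-all (¬? ∘ (x ≟_)) x∉xs))

-- Equality of the positive parts of two lists, as multisets

infix 4 _≈⁺_

record _≈⁺_ (xs ys : List ℕ) : Set where
  constructor mk≈⁺
  field mult⁺-≡ : ∀ w → mult (suc w) xs ≡ mult (suc w) ys

≈⁺-refl : xs ≈⁺ xs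
≈⁺-refl = mk≈⁺ λ _ → refl

≈⁺-sym : xs ≈⁺ ys → ys ≈⁺ xs
≈⁺-sym (mk≈⁺ xs≈ys) = mk≈⁺ λ w → sym (xs≈ys w)

≈⁺-trans : xs ≈⁺ ys → ys ≈⁺ us → xs ≈⁺ us
≈⁺-trans (mk≈⁺ xs≈ys) (mk≈⁺ ys≈us) = mk≈⁺ λ w → trans (xs≈ys w) (ys≈us w)

↭⇒≈⁺ : xs ↭ ys → xs ≈⁺ ys
↭⇒≈⁺ xs↭ys = mk≈⁺ λ w → mult-↭ (suc w) xs↭ys

0∷-≈⁺ : 0 ∷ xs ≈⁺ xs
0∷-≈⁺ = mk≈⁺ λ _ → refl

++⁺-≈⁺ : xs ≈⁺ ys → us ≈⁺ vs → xs ++ us ≈⁺ ys ++ vs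
++⁺-≈⁺ {xs} {ys} {us} {vs} (mk≈⁺ xs≈ys) (mk≈⁺ us≈vs) = mk≈⁺ λ w →
  trans (mult-++ (suc w) xs us) (trans (cong₂ _+_ (xs≈ys w) (us≈vs w)) (sym (mult-++ (suc w) ys vs)))

∷⁺-≈⁺ : ∀ x → xs ≈⁺ ys → x ∷ xs ≈⁺ x ∷ ys
∷⁺-≈⁺ x = ++⁺-≈⁺ {[ x ]} ≈⁺-refl

≈⁺-cancelˡ : ∀ zs → zs ++ xs ≈⁺ zs ++ ys → xs ≈⁺ ys
≈⁺-cancelˡ {xs} {ys} zs (mk≈⁺ e) = mk≈⁺ λ w → +-cancelˡ-≡ (mult (suc w) zs) _ _
  (trans (sym (mult-++ (suc w) zs xs)) (trans (e w) (mult-++ (suc w) zs ys)))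

≈⁺-cancelʳ : ∀ zs → xs ++ zs ≈⁺ ys ++ zs → xs ≈⁺ ys
≈⁺-cancelʳ {xs} {ys} zs (mk≈⁺ e) = mk≈⁺ λ w → +-cancelʳ-≡ (mult (suc w) zs) _ _
  (trans (sym (mult-++ (suc w) xs zs)) (trans (e w) (mult-++ (suc w) ys zs)))

≈⁺-exchange : ∀ as bs as′ bs′ → as ++ μ ≈⁺ bs ++ l → as′ ++ μ ≈⁺ bs′ ++ l → as ++ bs′ ≈⁺ as′ ++ bs
≈⁺-exchange {μ} {l} as bs as′ bs′ (mk≈⁺ e) (mk≈⁺ e′) = mk≈⁺ λ w → let c = mult (suc w) in
  trans (mult-++ (suc w) as bs′)
        (trans (+-cross-cancel {c as} {c bs} {c as′} {c bs′} {c μ} {c l}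
                               (split as bs e w) (split as′ bs′ e′ w))
               (sym (mult-++ (suc w) as′ bs)))
  where
  split : ∀ cs ds → (∀ w → mult (suc w) (cs ++ μ) ≡ mult (suc w) (ds ++ l)) →
          ∀ w → mult (suc w) cs + mult (suc w) μ ≡ mult (suc w) ds + mult (suc w) l
  split cs ds e w = trans (sym (mult-++ (suc w) cs μ)) (trans (e w) (mult-++ (suc w) ds l))

≈⁺-∈ : xs ≈⁺ ys → suc w ∈ xs → suc w ∈ ys
≈⁺-∈ (mk≈⁺ xs≈ys) x∈xs = mult>0⇒∈ (subst (0 <_) (xs≈ys _) (∈⇒mult>0 x∈xs))

removeZeros-≈⁺ : ∀ xs → removeZeros xs ≈⁺ xs
removeZeros-≈⁺ [] = ≈⁺-refl
removeZeros-≈⁺ (zero ∷ xs) = ≈⁺-trans (removeZeros-≈⁺ xs) (≈⁺-sym 0∷-≈⁺)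
removeZeros-≈⁺ (suc x ∷ xs) = ∷⁺-≈⁺ (suc x) (removeZeros-≈⁺ xs)

removeZeros-positive : ∀ xs → All (1 ≤_) (removeZeros xs)
removeZeros-positive [] = []
removeZeros-positive (zero ∷ xs) = removeZeros-positive xs
removeZeros-positive (suc x ∷ xs) = s≤s z≤n ∷ removeZeros-positive xs

Descending-head-max : Linked _≥_ (x ∷ xs) → y ∈ x ∷ xs → y ≤ x
Descending-head-max _ (here refl) = ≤-refl
Descending-head-max xs↘ (there y∈xs) =
  All.lookup (AllPairs.head (Linked⇒AllPairs (λ x≥y y≥z → ≤-trans y≥z x≥y) xs↘)) y∈xs

IsPartition-tail : IsPartition (x ∷ xs) → IsPartition xs
IsPartition-tail ([-] , _ ∷ pos) = [] , pos
IsPartition-tail (_ ∷ xs↘ , _ ∷ pos) = xs↘ , pos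

partition-≈⁺⇒≡ : IsPartition xs → IsPartition ys → xs ≈⁺ ys → xs ≡ ys
partition-≈⁺⇒≡ {[]} {[]} _ _ _ = refl
partition-≈⁺⇒≡ {[]} {suc y ∷ ys} _ _ xs≈ys with ≈⁺-∈ (≈⁺-sym xs≈ys) (here refl)
... | ()
partition-≈⁺⇒≡ {suc x ∷ xs} {[]} _ _ xs≈ys with ≈⁺-∈ xs≈ys (here refl)
... | ()
partition-≈⁺⇒≡ {suc x ∷ xs} {suc y ∷ ys} xs-part ys-part xs≈ys
  with ≤-antisym (Descending-head-max (proj₁ ys-part) (≈⁺-∈ xs≈ys (here refl)))
                 (Descending-head-max (proj₁ xs-part) (≈⁺-∈ (≈⁺-sym xs≈ys) (here refl)))
... | refl = cong (suc x ∷_) (partition-≈⁺⇒≡ (IsPartition-tail xs-part) (IsPartition-tail ys-part)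
                                              (≈⁺-cancelˡ [ suc x ] xs≈ys))
partition-≈⁺⇒≡ {zero ∷ _} (_ , () ∷ _) _ _
partition-≈⁺⇒≡ {_} {zero ∷ _} _ (_ , () ∷ _) _

at : List ℕ → ℕ → ℕ
at [] _ = 0
at (x ∷ _) zero = x
at (_ ∷ xs) (suc i) = at xs i

index : ℕ → List ℕ → ℕ
index x [] = 0
index x (y ∷ ys) = if does (x ≟ y) then 0 else suc (index x ys)

at-∈ : ∀ {i} → i < length xs → at xs i ∈ xs
at-∈ {xs = x ∷ xs} {zero} _ = here refl
at-∈ {xs = x ∷ xs} {suc i} (s≤s i<) = there (at-∈ i<)

index-spec : x ∈ xs → index x xs < length xs × at xs (index x xs) ≡ x
index-spec {x} {y ∷ ys} x∈ with does (x ≟ y) | proof (x ≟ y) | x∈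
... | true  | ofʸ x≡y | _           = s≤s z≤n , sym x≡y
... | false | ofⁿ x≢y | here x≡y    = contradiction x≡y x≢y
... | false | _       | there x∈ys = map₁ s≤s (index-spec x∈ys)

length-modAt : ∀ i f xs → length (modAt i f xs) ≡ length xs
length-modAt i f [] = refl
length-modAt zero f (x ∷ xs) = refl
length-modAt (suc i) f (x ∷ xs) = cong suc (length-modAt i f xs)

at-modAt-≢ : ∀ {i j f} xs → j ≢ i → at (modAt i f xs) j ≡ at xs j
at-modAt-≢ [] _ = refl
at-modAt-≢ {i = zero} {zero} (x ∷ xs) j≢i = contradiction refl j≢i
at-modAt-≢ {i = suc i} {zero} (x ∷ xs) _ = refl
at-modAt-≢ {i = zero} {suc j} (x ∷ xs) _ = refl
at-modAt-≢ {i = suc i} {suc j} (x ∷ xs) j≢i = at-modAt-≢ xs (j≢i ∘ cong suc)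

at-modAt-≡ : ∀ {i f} → i < length xs → at (modAt i f xs) i ≡ f (at xs i)
at-modAt-≡ {xs = x ∷ xs} {zero} _ = refl
at-modAt-≡ {xs = x ∷ xs} {suc i} {f} (s≤s i<) = at-modAt-≡ {xs = xs} {f = f} i<

modAt-↭ : ∀ {i f} → i < length xs → at xs i ∷ modAt i f xs ↭ f (at xs i) ∷ xs
modAt-↭ {xs = x ∷ xs} {zero} _ = swap x _ ↭-refl
modAt-↭ {xs = x ∷ xs} {suc i} {f} (s≤s i<) = begin
  at xs i ∷ x ∷ modAt i f xs   ↭⟨ swap _ _ ↭-refl ⟩
  x ∷ at xs i ∷ modAt i f xs   ↭⟨ prep x (modAt-↭ i<) ⟩
  x ∷ f (at xs i) ∷ xs         ↭⟨ swap _ _ ↭-refl ⟩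
  f (at xs i) ∷ x ∷ xs         ∎
  where open PermutationReasoning

at≡at⇒mult≥2 : ∀ {i j} → i ≢ j → i < length xs → j < length xs → at xs i ≡ at xs j → 2 ≤ mult (at xs i) xs
at≡at⇒mult≥2 {i = zero} {zero} i≢j _ _ _ = contradiction refl i≢j
at≡at⇒mult≥2 {x ∷ xs} {zero} {suc j} _ _ (s≤s j<) x≡ =
  subst (2 ≤_) (sym (mult-here x xs)) (s≤s (∈⇒mult>0 (subst (_∈ xs) (sym x≡) (at-∈ j<))))
at≡at⇒mult≥2 {x ∷ xs} {suc i} {zero} _ (s≤s i<) _ ≡x rewrite ≡x =
  subst (2 ≤_) (sym (mult-here x xs)) (s≤s (∈⇒mult>0 (subst (_∈ xs) ≡x (at-∈ i<))))
at≡at⇒mult≥2 {x ∷ xs} {suc i} {suc j} i≢j (s≤s i<) (s≤s j<) at≡at =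
  ≤-trans (at≡at⇒mult≥2 {xs = xs} (i≢j ∘ cong suc) i< j< at≡at) (mult-∷-≤ _ x xs)

-- Moves

-- μ arises from l by moving a cell from a part of size s to one of size t;
-- t = 0 stands for a new part and pred s = 0 for a part that disappears,
-- both of which _≈⁺_ ignores.
Moved : List ℕ → ℕ → ℕ → List ℕ → Set
Moved l s t μ = s ∷ t ∷ μ ≈⁺ pred s ∷ suc t ∷ l

donor : Step l ν → ℕ
donor {l} (toPart i _ _ _ _) = at l i
donor {l} (toNew i _)        = at l i

receiver : Step l ν → ℕ
receiver {l} (toPart _ j _ _ _) = at l j
receiver     (toNew _ _)        = 0

Step⇒Moved : (st : Step l ν) → Moved l (donor st) (receiver st) ν
Step⇒Moved {l} (toPart i j i<l j<l i≢j) = ↭⇒≈⁺ (begin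
  at l i ∷ at l j ∷ modAt j suc l′         ≡⟨ cong (λ b → at l i ∷ b ∷ modAt j suc l′) at-l′-j ⟨
  at l i ∷ at l′ j ∷ modAt j suc l′        ↭⟨ prep (at l i) (modAt-↭ j<l′) ⟩
  at l i ∷ suc (at l′ j) ∷ l′              ↭⟨ swap _ _ ↭-refl ⟩
  suc (at l′ j) ∷ at l i ∷ l′              ↭⟨ prep (suc (at l′ j)) (modAt-↭ i<l) ⟩
  suc (at l′ j) ∷ pred (at l i) ∷ l        ↭⟨ swap _ _ ↭-refl ⟩
  pred (at l i) ∷ suc (at l′ j) ∷ l        ≡⟨ cong (λ b → pred (at l i) ∷ suc b ∷ l) at-l′-j ⟩
  pred (at l i) ∷ suc (at l j) ∷ l         ∎)
  where
  open PermutationReasoning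
  l′ = modAt i pred l
  at-l′-j : at l′ j ≡ at l j
  at-l′-j = at-modAt-≢ l (i≢j ∘ sym)
  j<l′ : j < length l′
  j<l′ = subst (j <_) (sym (length-modAt i pred l)) j<l
Step⇒Moved {l} (toNew i i<l) = ≈⁺-trans (∷⁺-≈⁺ (at l i) 0∷-≈⁺) (↭⇒≈⁺ (begin
  at l i ∷ (l′ ++ [ 1 ])   ↭⟨ ∷↭∷ʳ 1 (at l i ∷ l′) ⟨
  1 ∷ at l i ∷ l′          ↭⟨ prep 1 (modAt-↭ i<l) ⟩
  1 ∷ pred (at l i) ∷ l    ↭⟨ swap _ _ ↭-refl ⟩
  pred (at l i) ∷ 1 ∷ l    ∎))
  where
  open PermutationReasoning
  l′ = modAt i pred l

Moved-resp-≈⁺ : μ ≈⁺ μ′ → Moved l s t μ → Moved l s t μ′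
Moved-resp-≈⁺ {s = s} {t} μ≈μ′ moved = ≈⁺-trans (≈⁺-sym (∷⁺-≈⁺ s (∷⁺-≈⁺ t μ≈μ′))) moved

Moved-unique : Moved l s t μ → Moved l s t μ′ → μ ≈⁺ μ′
Moved-unique {s = s} {t} moved moved′ = ≈⁺-cancelˡ (s ∷ t ∷ []) (≈⁺-trans moved (≈⁺-sym moved′))

Moved-idle : ∀ l t → Moved l (suc t) t l
Moved-idle l t = ↭⇒≈⁺ (swap (suc t) t ↭-refl)

¬Moved-self : 1 ≤ s → suc t ≢ s → ¬ Moved l s t l
¬Moved-self {l = l} (s≤s z≤n) not-idle moved
  with ≈⁺-∈ (≈⁺-cancelʳ l moved) (here refl)
... | here ()
... | there (here s≡1+t) = not-idle (sym s≡1+t)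

-- Chase the positive entries suc a, suc a′ and suc t′ from one side to the other.
exchange⇒same-donor : suc t ≢ suc a → suc t′ ≢ suc a′ →
  suc a ∷ t ∷ a′ ∷ suc t′ ∷ [] ≈⁺ suc a′ ∷ t′ ∷ a ∷ suc t ∷ [] → a ≡ a′
exchange⇒same-donor not-idle not-idle′ E with ≈⁺-∈ E (here refl)
... | here refl = refl
... | there (there (here ()))
... | there (there (there (here refl))) = contradiction refl not-idle
... | there (here refl) with ≈⁺-∈ (≈⁺-sym E) (here refl)
...   | here refl = refl
...   | there (there (here ()))
...   | there (there (there (here refl))) = contradiction refl not-idle′
...   | there (here refl) with ≈⁺-∈ E (there (there (there (here refl))))
...     | here refl = contradiction refl not-idle′
...     | there (here ())
...     | there (there (here ()))
...     | there (there (there (here refl))) = refl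

exchange⇒same-receiver : suc t ≢ suc a → suc t′ ≢ suc a →
  suc a ∷ t ∷ a ∷ suc t′ ∷ [] ≈⁺ suc a ∷ t′ ∷ a ∷ suc t ∷ [] → t ≡ t′
exchange⇒same-receiver not-idle not-idle′ E with ≈⁺-∈ (≈⁺-sym E) (there (there (there (here refl))))
... | here refl = contradiction refl not-idle
... | there (here ())
... | there (there (there (here refl))) = refl
... | there (there (here refl)) with ≈⁺-∈ E (there (there (there (here refl))))
...   | here refl = contradiction refl not-idle′
...   | there (here ())
...   | there (there (here refl)) = refl
...   | there (there (there (here refl))) = refl

Moved-injective : 1 ≤ s → 1 ≤ s′ → suc t ≢ s → suc t′ ≢ s′ →
                  Moved l s t μ → Moved l s′ t′ μ → s ≡ s′ × t ≡ t′
Moved-injective {suc a} {suc a′} {t} {t′} _ _ not-idle not-idle′ moved moved′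
  with ≈⁺-exchange (suc a ∷ t ∷ []) (a ∷ suc t ∷ []) (suc a′ ∷ t′ ∷ []) (a′ ∷ suc t′ ∷ []) moved moved′
... | E with exchange⇒same-donor not-idle not-idle′ E
...   | refl = refl , exchange⇒same-receiver not-idle not-idle′ E

takeCell : List ℕ → ℕ → List ℕ
takeCell l s = modAt (index s l) pred l

moveCell : List ℕ → ℕ → ℕ → List ℕ
moveCell l s zero    = takeCell l s ++ [ 1 ]
moveCell l s (suc t) = modAt (index (suc t) (takeCell l s)) suc (takeCell l s)

takeCell-↭ : s ∈ l → s ∷ takeCell l s ↭ pred s ∷ l
takeCell-↭ {s} {l} s∈l = subst (λ x → x ∷ takeCell l s ↭ pred x ∷ l) at≡s (modAt-↭ i<)
  where
  i<   = proj₁ (index-spec s∈l)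
  at≡s = proj₂ (index-spec s∈l)

moveCell-toNew : s ∈ l → Σ[ st ∈ Step l (moveCell l s 0) ] (donor st ≡ s × receiver st ≡ 0)
moveCell-toNew s∈l = toNew _ (proj₁ (index-spec s∈l)) , proj₂ (index-spec s∈l) , refl

moveCell-toPart : s ∈ l → suc t ∈ takeCell l s → suc t ≢ pred s →
                  Σ[ st ∈ Step l (moveCell l s (suc t)) ] (donor st ≡ s × receiver st ≡ suc t)
moveCell-toPart {s} {l} {t} s∈l t∈l′ t≢pred-s =
  toPart i j i<l j<l i≢j , at-l-i , trans (sym (at-modAt-≢ l (i≢j ∘ sym))) at-l′-j
  where
  l′     = takeCell l s
  i      = index s l
  i<l    = proj₁ (index-spec s∈l)
  at-l-i = proj₂ (index-spec s∈l)
  j      = index (suc t) l′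
  at-l′-j = proj₂ (index-spec t∈l′)
  j<l : j < length l
  j<l = subst (j <_) (length-modAt i pred l) (proj₁ (index-spec t∈l′))
  i≢j : i ≢ j
  i≢j i≡j = t≢pred-s (begin
    suc t           ≡⟨ at-l′-j ⟨
    at l′ j         ≡⟨ cong (at l′) i≡j ⟨
    at l′ i         ≡⟨ at-modAt-≡ {l} {f = pred} i<l ⟩
    pred (at l i)   ≡⟨ cong pred at-l-i ⟩
    pred s          ∎)
    where open ≡-Reasoning

suc≢⇒≢pred : 1 ≤ s → suc t ≢ s → t ≢ pred s
suc≢⇒≢pred (s≤s z≤n) not-idle refl = not-idle refl

-- The neighbours of a partition and their number

Tight : List ℕ → ℕ → Set
Tight l s = mult s l ≡ 1 × pred s ∈ distinctParts l ++ [ 0 ]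

module Neighbours {l : List ℕ} (l-partition : IsPartition l) where

  sizes : List ℕ
  sizes = distinctParts l

  targets : List ℕ
  targets = sizes ++ [ 0 ]

  Valid : ℕ → ℕ → Set
  Valid s t = suc t ≢ s × (t ≢ s ⊎ 2 ≤ mult s l)

  Valid? : ∀ s t → Dec (Valid s t)
  Valid? s t = ¬? (suc t ≟ s) ×-dec (¬? (t ≟ s) ⊎-dec (2 ≤? mult s l))

  parts-positive : x ∈ l → 1 ≤ x
  parts-positive = All.lookup (proj₂ l-partition)

  sizes⊆l : sizes ⊆ l
  sizes⊆l = ∈-deduplicate⁻ _≟_ l

  l⊆sizes : l ⊆ sizes
  l⊆sizes = ∈-deduplicate⁺ _≟_

  targets-unique : Unique targets
  targets-unique = ++⁺ (deduplicate-! l) ([] ∷ []) λ where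
    (0∈sizes , here refl) → contradiction (parts-positive (sizes⊆l 0∈sizes)) λ ()

  donor-∈ : (st : Step l ν) → donor st ∈ l
  donor-∈ (toPart _ _ i<l _ _) = at-∈ i<l
  donor-∈ (toNew _ i<l)        = at-∈ i<l

  receiver-∈ : (st : Step l ν) → receiver st ∈ targets
  receiver-∈ (toPart _ _ _ j<l _) = ∈-++⁺ˡ (l⊆sizes (at-∈ j<l))
  receiver-∈ (toNew _ _)          = ∈-++⁺ʳ sizes (here refl)

  Step⇒distinct-or-repeated : (st : Step l ν) → receiver st ≢ donor st ⊎ 2 ≤ mult (donor st) l
  Step⇒distinct-or-repeated (toPart i j i<l j<l i≢j) with at l j ≟ at l i
  ... | yes same = inj₂ (at≡at⇒mult≥2 {l} i≢j i<l j<l (sym same))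
  ... | no  differ = inj₁ differ
  Step⇒distinct-or-repeated (toNew i i<l) = inj₁ (<⇒≢ (parts-positive (at-∈ i<l)))

  Adj⇒validMove : Adj l μ → ∃₂ λ s t → s ∈ sizes × t ∈ targets × Valid s t × Moved l s t μ
  Adj⇒validMove {μ} (μ-partition , l≢μ , ν , st , ν↭μ) =
    donor st , receiver st , l⊆sizes (donor-∈ st) , receiver-∈ st ,
    (not-idle , Step⇒distinct-or-repeated st) , moved
    where
    moved : Moved l (donor st) (receiver st) μ
    moved = Moved-resp-≈⁺ (≈⁺-trans (≈⁺-sym (removeZeros-≈⁺ ν)) (↭⇒≈⁺ ν↭μ)) (Step⇒Moved st)
    not-idle : suc (receiver st) ≢ donor st
    not-idle idle = l≢μ (partition-≈⁺⇒≡ l-partition μ-partition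
      (Moved-unique (subst (λ s → Moved l s (receiver st) l) idle (Moved-idle l (receiver st))) moved))

  receiver-∈-takeCell : s ∈ l → t ∈ l → Valid s t → t ∈ takeCell l s
  receiver-∈-takeCell {s} {t} s∈l t∈l (not-idle , t-ok) = mult>0⇒∈ (occurs (t ≟ s) t-ok)
    where
    takeCell-mult : mult t (s ∷ takeCell l s) ≡ mult t l
    takeCell-mult = trans (mult-↭ t (takeCell-↭ s∈l))
                          (mult-there (suc≢⇒≢pred (parts-positive s∈l) not-idle))
    occurs : Dec (t ≡ s) → t ≢ s ⊎ 2 ≤ mult s l → 0 < mult t (takeCell l s)
    occurs (yes refl) (inj₁ t≢s)  = contradiction refl t≢s
    occurs (yes refl) (inj₂ twice) = s≤s⁻¹ (subst (2 ≤_) (trans (sym takeCell-mult) (mult-here t _)) twice)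
    occurs (no t≢s) _ = subst (0 <_) (trans (sym takeCell-mult) (mult-there t≢s)) (∈⇒mult>0 t∈l)

  moveCell-Step : s ∈ sizes → t ∈ targets → Valid s t →
                  Σ[ st ∈ Step l (moveCell l s t) ] (donor st ≡ s × receiver st ≡ t)
  moveCell-Step {s} {zero} s∈sizes _ _ = moveCell-toNew (sizes⊆l s∈sizes)
  moveCell-Step {s} {suc t} s∈sizes t∈targets valid@(not-idle , _) with ∈-++⁻ sizes t∈targets
  ... | inj₁ t∈sizes = moveCell-toPart (sizes⊆l s∈sizes)
                         (receiver-∈-takeCell (sizes⊆l s∈sizes) (sizes⊆l t∈sizes) valid)
                         (suc≢⇒≢pred (parts-positive (sizes⊆l s∈sizes)) not-idle)
  ... | inj₂ (here ())

  neighbour : ℕ → ℕ → List ℕ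
  neighbour s t = sort (removeZeros (moveCell l s t))

  neighbour-isPartition : ∀ s t → IsPartition (neighbour s t)
  neighbour-isPartition s t =
    sort-↗ _ , All-resp-↭ (↭-sym (sort-↭ _)) (removeZeros-positive (moveCell l s t))

  neighbour-Moved : s ∈ sizes → t ∈ targets → Valid s t → Moved l s t (neighbour s t)
  neighbour-Moved {s} {t} s∈ t∈ valid with moveCell-Step s∈ t∈ valid
  ... | st , donor≡s , receiver≡t =
    Moved-resp-≈⁺ (≈⁺-trans (≈⁺-sym (removeZeros-≈⁺ _)) (↭⇒≈⁺ (↭-sym (sort-↭ _))))
                  (subst₂ (λ s t → Moved l s t _) donor≡s receiver≡t (Step⇒Moved st))

  neighbour-Adj : s ∈ sizes → t ∈ targets → Valid s t → Adj l (neighbour s t)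
  neighbour-Adj {s} {t} s∈ t∈ valid@(not-idle , _) =
    neighbour-isPartition s t ,
    (λ l≡ → ¬Moved-self (parts-positive (sizes⊆l s∈)) not-idle
              (subst (Moved l s t) (sym l≡) (neighbour-Moved s∈ t∈ valid))) ,
    moveCell l s t , proj₁ (moveCell-Step s∈ t∈ valid) , ↭-sym (sort-↭ _)

  pairs : List (ℕ × ℕ)
  pairs = filter (uncurry Valid?) (cartesianProduct sizes targets)

  ∈-pairs⁻ : (s , t) ∈ pairs → s ∈ sizes × t ∈ targets × Valid s t
  ∈-pairs⁻ p∈ with ∈-filter⁻ (uncurry Valid?) p∈
  ... | p∈product , valid = proj₁ (∈-cartesianProduct⁻ sizes targets p∈product) ,
                            proj₂ (∈-cartesianProduct⁻ sizes targets p∈product) , valid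

  neighbours : List (List ℕ)
  neighbours = map (uncurry neighbour) pairs

  neighbours⊆Adj : μ ∈ neighbours → Adj l μ
  neighbours⊆Adj μ∈ with ∈-map⁻ (uncurry neighbour) μ∈
  ... | (s , t) , p∈ , refl with ∈-pairs⁻ p∈
  ...   | s∈ , t∈ , valid = neighbour-Adj s∈ t∈ valid

  Adj⊆neighbours : Adj l μ → μ ∈ neighbours
  Adj⊆neighbours adj@(μ-partition , _) with Adj⇒validMove adj
  ... | s , t , s∈ , t∈ , valid , moved = subst (_∈ neighbours) (sym μ≡neighbour)
    (∈-map⁺ (uncurry neighbour) (∈-filter⁺ (uncurry Valid?) (∈-cartesianProduct⁺ s∈ t∈) valid))
    where
    μ≡neighbour = partition-≈⁺⇒≡ μ-partition (neighbour-isPartition s t)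
                    (Moved-unique moved (neighbour-Moved s∈ t∈ valid))

  neighbours-unique : Unique neighbours
  neighbours-unique =
    Unique-map⁺ injective (filter⁺ (uncurry Valid?) (cartesianProduct⁺ (deduplicate-! l) targets-unique))
    where
    injective : ∀ {p q} → p ∈ pairs → q ∈ pairs → uncurry neighbour p ≡ uncurry neighbour q → p ≡ q
    injective {s , t} {s′ , t′} p∈ q∈ same with ∈-pairs⁻ p∈ | ∈-pairs⁻ q∈
    ... | s∈ , t∈ , valid | s′∈ , t′∈ , valid′
      with Moved-injective (parts-positive (sizes⊆l s∈)) (parts-positive (sizes⊆l s′∈))
             (proj₁ valid) (proj₁ valid′) (neighbour-Moved s∈ t∈ valid)
             (subst (Moved l s′ t′) (sym same) (neighbour-Moved s′∈ t′∈ valid′))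
    ...   | refl , refl = refl

  receiverCount : ℕ → ℕ
  receiverCount s = length (filter (Valid? s) targets)

  ∈-neighbours⇔Adj : μ ∈ neighbours ⇔ Adj l μ
  ∈-neighbours⇔Adj = mk⇔ neighbours⊆Adj Adj⊆neighbours

  length-neighbours : length neighbours ≡ sum (map receiverCount sizes)
  length-neighbours = trans (length-map (uncurry neighbour) pairs)
                            (length-filter-cartesianProduct (uncurry Valid?) sizes targets)

  degree-unique : ∀ {d} → DegreeIs l d → d ≡ sum (map receiverCount sizes)
  degree-unique (L , L-unique , L⇔Adj , refl) = trans
    (Unique-length-≡ (≡-dec _≟_) L-unique neighbours-unique
                     (⇔.trans (L⇔Adj _) (⇔.sym ∈-neighbours⇔Adj)))
    length-neighbours

  degree-exists : DegreeIs l (sum (map receiverCount sizes))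
  degree-exists = neighbours , neighbours-unique , (λ _ → ∈-neighbours⇔Adj) , length-neighbours

  nonReceivers : ℕ → List ℕ
  nonReceivers s = filter (∁? (Valid? s)) targets

  receivers+nonReceivers : ∀ s → receiverCount s + length (nonReceivers s) ≡ σ l + 1
  receivers+nonReceivers s = trans (length-filter+∁ (Valid? s) targets) (length-++ sizes)

  invalid⇒idle-or-single : ¬ Valid s t → suc t ≡ s ⊎ (t ≡ s × ¬ 2 ≤ mult s l)
  invalid⇒idle-or-single {s} {t} invalid with suc t ≟ s | t ≟ s | 2 ≤? mult s l
  ... | yes idle | _        | _        = inj₁ idle
  ... | no  not-idle | yes t≡s | no single = inj₂ (t≡s , single)
  ... | no  not-idle | no t≢s  | _         = contradiction (not-idle , inj₁ t≢s) invalid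
  ... | no  not-idle | yes _   | yes twice = contradiction (not-idle , inj₂ twice) invalid

  nonReceivers≤ : ∀ xs → (∀ {t} → t ∈ targets → ¬ Valid s t → t ∈ xs) → length (nonReceivers s) ≤ length xs
  nonReceivers≤ {s} _ ⊆xs = Unique-⊆⇒length≤ _≟_ (filter⁺ (∁? (Valid? s)) targets-unique)
    λ t∈ → let t∈targets , invalid = ∈-filter⁻ (∁? (Valid? s)) t∈ in ⊆xs t∈targets invalid

  nonReceivers≤2 : ∀ s → length (nonReceivers s) ≤ 2
  nonReceivers≤2 s = nonReceivers≤ (s ∷ pred s ∷ []) λ {t} _ invalid → case t invalid
    where
    case : ∀ t → ¬ Valid s t → t ∈ s ∷ pred s ∷ []
    case t invalid with invalid⇒idle-or-single invalid
    ... | inj₁ refl         = there (here refl)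
    ... | inj₂ (refl , _)   = here refl

  repeated⇒nonReceivers≤1 : 2 ≤ mult s l → length (nonReceivers s) ≤ 1
  repeated⇒nonReceivers≤1 {s} twice = nonReceivers≤ [ pred s ] λ {t} _ invalid → here (idle t invalid)
    where
    idle : ∀ t → ¬ Valid s t → t ≡ pred s
    idle t invalid with invalid⇒idle-or-single invalid
    ... | inj₁ refl         = refl
    ... | inj₂ (_ , single) = contradiction twice single

  gap⇒nonReceivers≤1 : pred s ∉ targets → length (nonReceivers s) ≤ 1
  gap⇒nonReceivers≤1 {s} pred-s∉ = nonReceivers≤ [ s ] λ {t} t∈ invalid → here (self t t∈ invalid)
    where
    self : ∀ t → t ∈ targets → ¬ Valid s t → t ≡ s
    self t t∈ invalid with invalid⇒idle-or-single invalid
    ... | inj₁ refl      = contradiction t∈ pred-s∉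
    ... | inj₂ (t≡s , _) = t≡s

  Tight⇒2≤nonReceivers : s ∈ sizes → Tight l s → 2 ≤ length (nonReceivers s)
  Tight⇒2≤nonReceivers {s} s∈ (single , pred-s∈) with parts-positive (sizes⊆l s∈)
  ... | s≤s z≤n = Unique-⊆⇒length≤ _≟_ (((λ ()) ∷ []) ∷ [] ∷ []) λ
    { (here refl)         → ∈-filter⁺ (∁? (Valid? s)) (∈-++⁺ˡ s∈) ¬self
    ; (there (here refl)) → ∈-filter⁺ (∁? (Valid? s)) pred-s∈ λ (not-idle , _) → not-idle refl }
    where
    ¬self : ¬ Valid s s
    ¬self (_ , inj₁ s≢s)   = s≢s refl
    ¬self (_ , inj₂ twice) = contradiction (subst (2 ≤_) single twice) λ { (s≤s ()) }

  2≤nonReceivers⇒Tight : s ∈ sizes → 2 ≤ length (nonReceivers s) → Tight l s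
  2≤nonReceivers⇒Tight {s} s∈ 2≤ = single , pred-s∈
    where
    ≰1 : ¬ length (nonReceivers s) ≤ 1
    ≰1 ≤1 = contradiction (≤-trans 2≤ ≤1) λ { (s≤s ()) }
    single : mult s l ≡ 1
    single with mult s l ≤? 1
    ... | yes ≤1 = ≤-antisym ≤1 (∈⇒mult>0 (sizes⊆l s∈))
    ... | no  ≰1′ = contradiction (repeated⇒nonReceivers≤1 (≰⇒> ≰1′)) ≰1
    pred-s∈ : pred s ∈ targets
    pred-s∈ with pred s ∈? targets
    ... | yes pred-s∈ = pred-s∈
    ... | no  pred-s∉ = contradiction (gap⇒nonReceivers≤1 pred-s∉) ≰1

  receiverCount-≥ : ∀ s → σ l ∸ 1 ≤ receiverCount s
  receiverCount-≥ s = m+n≡o+1⇒o∸1≤m (receivers+nonReceivers s) (nonReceivers≤2 s)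

  receiverCount-≡⇔Tight : s ∈ sizes → receiverCount s ≡ σ l ∸ 1 ⇔ Tight l s
  receiverCount-≡⇔Tight {s} s∈ = ⇔.trans
    (m+n≡o+1⇒[m≡o∸1⇔2≤n] (∈-length s∈) (receivers+nonReceivers s) (nonReceivers≤2 s))
    (mk⇔ (2≤nonReceivers⇒Tight s∈) (Tight⇒2≤nonReceivers s∈))

  degree⇔AllTight : DegreeIs l (σ l * (σ l ∸ 1)) ⇔ All (Tight l) sizes
  degree⇔AllTight = ⇔.trans degree⇔sum (⇔.trans sum⇔ (All-⇔ receiverCount-≡⇔Tight))
    where
    sum⇔ = sum-map-≡⇔ receiverCount (σ l ∸ 1) (All.tabulate λ {s} _ → receiverCount-≥ s)
    degree⇔sum : DegreeIs l (σ l * (σ l ∸ 1)) ⇔ sum (map receiverCount sizes) ≡ σ l * (σ l ∸ 1)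
    degree⇔sum = mk⇔ (sym ∘ degree-unique) (λ eq → subst (DegreeIs l) eq degree-exists)

-- Staircases

Strict : List ℕ → Set
Strict = Linked _>_

Strict⇒AllPairs : Strict xs → AllPairs _>_ xs
Strict⇒AllPairs = Linked⇒AllPairs (λ x>y y>z → <-trans y>z x>y)

Strict⇒Unique : Strict xs → Unique xs
Strict⇒Unique = AllPairs.map >⇒≢ ∘ Strict⇒AllPairs

Strict-head-max : Strict (x ∷ xs) → y ∈ x ∷ xs → y ≤ x
Strict-head-max _ (here refl) = ≤-refl
Strict-head-max x∷xs↘ (there y∈xs) = <⇒≤ (All.lookup (AllPairs.head (Strict⇒AllPairs x∷xs↘)) y∈xs)

Descending+Unique⇒Strict : Linked _≥_ xs → Unique xs → Strict xs
Descending+Unique⇒Strict [] _ = []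
Descending+Unique⇒Strict [-] _ = [-]
Descending+Unique⇒Strict (y≤x ∷ y∷xs↘) (x∉ ∷ y∷xs-unique) =
  ≤∧≢⇒< y≤x (≢-sym (All.head x∉)) ∷ Descending+Unique⇒Strict y∷xs↘ y∷xs-unique

mult≡1⇒Unique : All (λ s → mult s l ≡ 1) (distinctParts l) → Unique l
mult≡1⇒Unique {l} single = mult≤1⇒Unique mult≤1
  where
  mult≤1 : ∀ v → mult v l ≤ 1
  mult≤1 v with v ∈? l
  ... | yes v∈l = ≤-reflexive (All.lookup single (∈-deduplicate⁺ _≟_ v∈l))
  ... | no  v∉l = subst (_≤ 1) (sym (∉⇒mult≡0 v∉l)) z≤n

∸≡1⇒≡suc : ∀ m n → m ∸ n ≡ 1 → m ≡ suc n
∸≡1⇒≡suc zero zero ()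
∸≡1⇒≡suc zero (suc n) ()
∸≡1⇒≡suc (suc m) zero m≡1 = m≡1
∸≡1⇒≡suc (suc m) (suc n) m∸n≡1 = cong suc (∸≡1⇒≡suc m n m∸n≡1)

gaps≡1⇒staircase : All (_≡ 1) (gaps xs) → xs ≡ staircase (length xs)
gaps≡1⇒staircase {[]} [] = refl
gaps≡1⇒staircase {x ∷ []} (refl ∷ []) = refl
gaps≡1⇒staircase {x ∷ y ∷ r} (x∸y≡1 ∷ gaps≡1) = cong₂ _∷_ x≡ y∷r≡
  where
  y∷r≡ : y ∷ r ≡ staircase (length (y ∷ r))
  y∷r≡ = gaps≡1⇒staircase gaps≡1
  x≡ : x ≡ suc (length (y ∷ r))
  x≡ = trans (∸≡1⇒≡suc x y x∸y≡1) (cong suc (∷-injectiveˡ y∷r≡))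

closed⇒gaps≡1 : Strict xs → All (1 ≤_) xs → (∀ {s} → s ∈ xs → pred s ∈ xs ++ [ 0 ]) →
                All (_≡ 1) (gaps xs)
closed⇒gaps≡1 {[]} _ _ _ = []
closed⇒gaps≡1 {suc x ∷ []} _ _ closed with closed (here refl)
... | here ()
... | there (here refl) = refl ∷ []
closed⇒gaps≡1 {suc x ∷ y ∷ r} x∷y∷r↘@(y<x ∷ y∷r↘) (_ ∷ y∷r-pos) closed =
  gap ∷ closed⇒gaps≡1 y∷r↘ y∷r-pos closed′
  where
  closed′ : ∀ {s} → s ∈ y ∷ r → pred s ∈ y ∷ r ++ [ 0 ]
  closed′ s∈ with closed (there s∈)
  ... | here pred-s≡x = contradiction (≤-<-trans pred[n]≤n
          (All.lookup (AllPairs.head (Strict⇒AllPairs x∷y∷r↘)) s∈)) (<-irrefl pred-s≡x)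
  ... | there pred-s∈ = pred-s∈
  gap : suc x ∸ y ≡ 1
  gap with closed (here refl)
  ... | here ()
  ... | there x∈ = subst (λ z → suc x ∸ z ≡ 1) (≤-antisym (below-y x∈) (s≤s⁻¹ y<x)) (m+n∸n≡m 1 x)
    where
    below-y : ∀ {z} → z ∈ y ∷ r ++ [ 0 ] → z ≤ y
    below-y z∈ with ∈-++⁻ (y ∷ r) z∈
    ... | inj₁ z∈y∷r = Strict-head-max y∷r↘ z∈y∷r
    ... | inj₂ (here refl) = z≤n
closed⇒gaps≡1 {zero ∷ _} _ (() ∷ _) _

staircase-strict : ∀ r → Strict (staircase r)
staircase-strict zero = []
staircase-strict (suc zero) = [-]
staircase-strict (suc (suc r)) = ≤-refl ∷ staircase-strict (suc r)

pred-∈-staircase : ∀ {r} → s ∈ staircase r → pred s ∈ staircase r ++ [ 0 ]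
pred-∈-staircase {r = suc zero} (here refl) = there (here refl)
pred-∈-staircase {r = suc (suc r)} (here refl) = there (here refl)
pred-∈-staircase {r = suc r} (there s∈) = there (pred-∈-staircase s∈)

staircase-tight : ∀ r → All (Tight (staircase r)) (distinctParts (staircase r))
staircase-tight r = subst (All (Tight (staircase r))) (sym D≡stair) (All.tabulate λ s∈ →
  Unique-∈⇒mult≡1 stair-unique s∈ , subst (λ D → _ ∈ D ++ [ 0 ]) (sym D≡stair) (pred-∈-staircase s∈))
  where
  stair-unique = Strict⇒Unique (staircase-strict r)
  D≡stair = deduplicate-Unique stair-unique

UnitMultiplicitiesAndGaps : List ℕ → Set
UnitMultiplicitiesAndGaps l =
  All (λ s → mult s l ≡ 1) (distinctParts l) × All (λ g → g ≡ 1) (gaps (distinctParts l))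

AllTight⇒UnitMultiplicitiesAndGaps : IsPartition l → All (Tight l) (distinctParts l) → UnitMultiplicitiesAndGaps l
AllTight⇒UnitMultiplicitiesAndGaps {l} (l↘ , l-pos) tight =
  single , subst (λ D → All (_≡ 1) (gaps D)) (sym D≡l) (closed⇒gaps≡1 l-strict l-pos closed)
  where
  single = All.map proj₁ tight
  l-unique = mult≡1⇒Unique single
  D≡l = deduplicate-Unique l-unique
  l-strict = Descending+Unique⇒Strict l↘ l-unique
  closed : s ∈ l → pred s ∈ l ++ [ 0 ]
  closed {s} s∈ =
    subst (λ D → pred s ∈ D ++ [ 0 ]) D≡l (proj₂ (All.lookup tight (∈-deduplicate⁺ _≟_ s∈)))

UnitMultiplicitiesAndGaps⇒staircase : UnitMultiplicitiesAndGaps l → l ≡ staircase (σ l)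
UnitMultiplicitiesAndGaps⇒staircase (single , gaps≡1) =
  trans (sym (deduplicate-Unique (mult≡1⇒Unique single))) (gaps≡1⇒staircase gaps≡1)

staircase⇒AllTight : l ≡ staircase (σ l) → All (Tight l) (distinctParts l)
staircase⇒AllTight {l} l≡ = subst (λ l → All (Tight l) (distinctParts l)) (sym l≡) (staircase-tight (σ l))

proposition4p4 : (l : List ℕ) → IsPartition l →
    (DegreeIs l (σ l * (σ l ∸ 1)) ⇔ (All (λ s → mult s l ≡ 1) (distinctParts l) × All (λ g → g ≡ 1) (gaps (distinctParts l))))
    × ((All (λ s → mult s l ≡ 1) (distinctParts l) × All (λ g → g ≡ 1) (gaps (distinctParts l))) ⇔ l ≡ staircase (σ l))
proposition4p4 l l-partition =
  mk⇔ (tight⇒unit ∘ to) (from ∘ staircase⇒AllTight ∘ UnitMultiplicitiesAndGaps⇒staircase) ,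
  mk⇔ UnitMultiplicitiesAndGaps⇒staircase (tight⇒unit ∘ staircase⇒AllTight)
  where
  open Equivalence (Neighbours.degree⇔AllTight l-partition)
  tight⇒unit = AllTight⇒UnitMultiplicitiesAndGaps l-partition
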